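{- For all $m,d>0$, the polynomial $P_d(x_1,\ldots,x_m)$ can be computed by a non-commutative UPT circuit of size $O(m^2d)$.
   Context: Let $T_d$ be the complete binary tree of depth $d$ (with $2^d$ leaves) and $D=2^{d+1}-1$ its number of nodes; let $v_1,\ldots,v_D$ be its nodes listed in in-order (left subtree recursively, then the root, then the right subtree recursively). A colouring $\gamma:T_d\to\mathbb{Z}_m$ (colours identified with $[m]$) is legal if for every internal node $u$ with children $v,w$, $\gamma(u)=\gamma(v)+\gamma(w)\bmod m$. Define $P_d(x_1,\ldots,x_m)=\sum_{\gamma\text{ legal}}x_{\gamma(v_1)}x_{\gamma(v_2)}\cdots x_{\gamma(v_D)}\in\mathbb{F}\langle x_1,\ldots,x_m\rangle$ (non-commuting variables). A non-commutative circuit is a directed acyclic graph with one output, leaves labelled by variables or constants, internal gates $+$ or $\times$ (children of $\times$ ordered). A parse tree is obtained from the root by taking all ordered children at $\times$ gates and exactly one child at $+$ gates; the circuit (computing a homogeneous polynomial) is UPT if all its parse trees have the same shape, i.e. are identical up to gate names. -}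

module Defs where

open import Level using (Level; _⊔_) renaming (suc to lsuc)
open import Data.Nat using (ℕ; zero; suc; NonZero)
import Data.Nat as ℕ
open import Data.Nat.DivMod using (_mod_)
open import Data.Fin using (Fin; toℕ) renaming (zero to fzero; suc to fsuc; _≟_ to _≟ᶠ_)
open import Data.Bool using (Bool; true; false; _∧_; if_then_else_)
open import Data.List using (List; []; _∷_; map; concatMap; filter; foldr; length)
open import Data.List.Base using (allFin)
open import Data.List.Relation.Unary.Any using (Any)
open import Data.List.Relation.Binary.Pointwise using (Pointwise)
open import Data.List.Properties using (≡-dec)
open import Data.Product using (Σ; ∃; _×_; _,_)
open import Relation.Nullary using (¬_; does)
open import Relation.Binary.PropositionalEquality using (_≡_)
open import Algebra.Bundles using (CommutativeRing)

record Field (c ℓ : Level) : Set (lsuc (c ⊔ ℓ)) where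
  field
    commutativeRing : CommutativeRing c ℓ
  open CommutativeRing commutativeRing public
  field
    0≉1 : ¬ (0# ≈ 1#)
    inverse : ∀ x → ¬ (x ≈ 0#) → ∃ λ y → x * y ≈ 1#

-- Colours: Z_m identified with Fin m, addition mod m.

_+[_]_ : ∀ {m} → Fin m → (n : ℕ) → .{{NonZero n}} → Fin m → Fin n
(a +[ n ] b) = (toℕ a ℕ.+ toℕ b) mod n

-- Words over the alphabet x_1..x_m (monomials in non-commuting variables)
Word : ℕ → Set
Word m = List (Fin m)

-- Colourings of the complete binary tree T_d with colours Fin m.

data Colouring (m : ℕ) : ℕ → Set where
  leaf : Fin m → Colouring m zero
  node : ∀ {d} → Colouring m d → Fin m → Colouring m d → Colouring m (suc d)

rootColour : ∀ {m d} → Colouring m d → Fin m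
rootColour (leaf c) = c
rootColour (node _ c _) = c

legal : ∀ {m d} .{{_ : NonZero m}} → Colouring m d → Bool
legal (leaf _) = true
legal {m} (node l c r) =
  does (c ≟ᶠ (rootColour l +[ m ] rootColour r)) ∧ legal l ∧ legal r

inorder : ∀ {m d} → Colouring m d → Word m
inorder (leaf c) = c ∷ []
inorder (node l c r) = inorder l Data.List.++ (c ∷ inorder r)

allColourings : ∀ m d → List (Colouring m d)
allColourings m zero = map leaf (allFin m)
allColourings m (suc d) =
  concatMap (λ l → concatMap (λ c → map (λ r → node l c r) (allColourings m d))
                              (allFin m))
            (allColourings m d)

-- Non-commutative polynomials over a field, as coefficient functions
-- on words, with semantic equality coefficientwise.

module Poly {c ℓ} (F : Field c ℓ) where
  open Field F using (Carrier; _≈_; _+_; _*_; 0#; 1#)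

  NCPoly : ℕ → Set c
  NCPoly m = Word m → Carrier

  _≋_ : ∀ {m} → NCPoly m → NCPoly m → Set ℓ
  p ≋ q = ∀ w → p w ≈ q w

  0P : ∀ {m} → NCPoly m
  0P _ = 0#

  1P : ∀ {m} → NCPoly m
  1P [] = 1#
  1P (_ ∷ _) = 0#

  constP : ∀ {m} → Carrier → NCPoly m
  constP a [] = a
  constP a (_ ∷ _) = 0#

  monoP : ∀ {m} → Word m → NCPoly m
  monoP u w = if does (≡-dec _≟ᶠ_ u w) then 1# else 0#

  varP : ∀ {m} → Fin m → NCPoly m
  varP x = monoP (x ∷ [])

  _+P_ : ∀ {m} → NCPoly m → NCPoly m → NCPoly m
  (p +P q) w = p w + q w

  splits : ∀ {m} → Word m → List (Word m × Word m)
  splits [] = ([] , []) ∷ []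
  splits (a ∷ w) = ([] , a ∷ w) ∷ map (λ { (u , v) → (a ∷ u , v) }) (splits w)

  _*P_ : ∀ {m} → NCPoly m → NCPoly m → NCPoly m
  (p *P q) w = foldr (λ { (u , v) acc → p u * q v + acc }) 0# (splits w)

  sumP : ∀ {m} → List (NCPoly m) → NCPoly m
  sumP = foldr _+P_ 0P

  prodP : ∀ {m} → List (NCPoly m) → NCPoly m
  prodP = foldr _*P_ 1P

  P : (m d : ℕ) → .{{NonZero m}} → NCPoly m
  P m d = sumP (map (λ γ → monoP (inorder γ)) (filter (λ γ → legal γ Data.Bool.≟ true) (allColourings m d)))

  -- Non-commutative circuits, as a list of gates in topological order.
  -- A circuit with n gates is  g ∷ C  where C has the earlier gates;
  -- the children of a gate are references (Fin k) to the k earlier gates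
  -- (fzero = the most recently added one).  The output gate is the
  -- last-added gate (fzero).

  data Gate (m k : ℕ) : Set c where
    var   : Fin m → Gate m k
    const : Carrier → Gate m k
    add   : List (Fin k) → Gate m k
    mul   : List (Fin k) → Gate m k

  data Circuit (m : ℕ) : ℕ → Set c where
    []  : Circuit m zero
    _∷_ : ∀ {k} → Gate m k → Circuit m k → Circuit m (suc k)

  evalGate : ∀ {m k} → Gate m k → (Fin k → NCPoly m) → NCPoly m
  evalGate (var x) _ = varP x
  evalGate (const a) _ = constP a
  evalGate (add js) v = sumP (map v js)
  evalGate (mul js) v = prodP (map v js)

  eval : ∀ {m k} → Circuit m k → Fin k → NCPoly m
  eval (g ∷ C) fzero = evalGate g (eval C)
  eval (g ∷ C) (fsuc i) = eval C i

  output : ∀ {m k} → Circuit m (suc k) → NCPoly m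
  output C = eval C fzero

  fanIn : ∀ {m k} → Gate m k → ℕ
  fanIn (var _) = 0
  fanIn (const _) = 0
  fanIn (add js) = length js
  fanIn (mul js) = length js

  size : ∀ {m k} → Circuit m k → ℕ
  size [] = 0
  size (g ∷ C) = suc (fanIn g ℕ.+ size C)

  -- Parse trees, recorded by their shape (the parse tree up to gate
  -- names): leaves, + nodes (exactly one child) and × nodes (ordered
  -- children).

  data Shape : Set where
    leafS : Shape
    addS  : Shape → Shape
    mulS  : List Shape → Shape

  data HasParseTree {m : ℕ} : ∀ {k} → Circuit m k → Fin k → Shape → Set c where
    varT   : ∀ {k} {C : Circuit m k} x → HasParseTree (var x ∷ C) fzero leafS
    constT : ∀ {k} {C : Circuit m k} a → HasParseTree (const a ∷ C) fzero leafS
    addT   : ∀ {k} {C : Circuit m k} {js s} →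
             Any (λ j → HasParseTree C j s) js →
             HasParseTree (add js ∷ C) fzero (addS s)
    mulT   : ∀ {k} {C : Circuit m k} {js ss} →
             Pointwise (HasParseTree C) js ss →
             HasParseTree (mul js ∷ C) fzero (mulS ss)
    there  : ∀ {k} {C : Circuit m k} {g : Gate m k} {i s} →
             HasParseTree C i s → HasParseTree (g ∷ C) (fsuc i) s

  UPT : ∀ {m k} → Circuit m (suc k) → Set c
  UPT C = ∀ {s t} → HasParseTree C fzero s → HasParseTree C fzero t → s ≡ t

module Submission where

-- Write Proot d x for the sum of the monomials of the legal colourings of T_d with root colour x, so
-- that P_d = Σ_x Proot d x.  A colouring of T_{d+1} is a root colour between two colourings of T_d, and
-- it is legal with root x exactly when both halves are legal, with root colours a and b such that
-- a + b = x.  Reading colourings in-order, Proot 0 x = x_x and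
-- Proot (d+1) x = Σ_{a+b=x} Proot d a · x_{a+b} · Proot d b.  Computing the m polynomials Proot d x
-- level by level takes, per level, m² product gates of fan-in 3 and m sum gates whose fan-ins add up
-- to m², hence O(m² d) in total; and all parse trees at the gate of Proot d x have the same shape, sum
-- nodes alternating with ternary product nodes down to depth d.

open import Defs

open import Level using (Level; _⊔_)
open import Function using (_∘_; id)
open import Data.Nat using (ℕ; zero; suc; NonZero; _≤_)
import Data.Nat as ℕ
import Data.Nat.Properties as ℕP
open import Data.Nat.Tactic.RingSolver using (solve-∀)
open import Data.Bool using (Bool; true; false; _∧_; if_then_else_)
import Data.Bool as Bool
open import Data.Bool.Properties using (∧-zeroʳ; ∧-identityʳ)
open import Data.Product using (Σ; ∃; _×_; _,_; proj₁; proj₂)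
open import Data.Fin using (Fin; _↑ˡ_; _↑ʳ_) renaming (zero to fzero; suc to fsuc; _≟_ to _≟ᶠ_)
open import Data.Fin.Properties using (suc-injective)
open import Data.List
  using (List; []; _∷_; _++_; map; concatMap; cartesianProduct; filter; foldr; length; tabulate; lookup; allFin)
open import Data.List.Properties
  using (map-tabulate; tabulate-lookup; foldr-map; map-∘; length-map; length-tabulate; ∷-injectiveˡ; ∷-injectiveʳ; ≡-dec)
open import Data.List.Relation.Unary.All as All using (All)
open import Data.List.Relation.Unary.All.Properties using (gmap⁺; map⁺)
open import Data.List.Relation.Binary.Pointwise using (Pointwise; []; _∷_)
open import Relation.Nullary using (does; Dec; yes; no)
open import Relation.Nullary.Decidable using (dec-true; dec-false)
open import Relation.Unary using (Pred; Decidable)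
open import Relation.Binary.PropositionalEquality as ≡ using (_≡_; _≢_)
import Relation.Binary.Reasoning.Setoid as ≈-Reasoning
open import Algebra.Bundles using (CommutativeMonoid)

module ListSum {c ℓ} (M : CommutativeMonoid c ℓ) where
  open CommutativeMonoid M
  open ≈-Reasoning setoid

  sumOver : ∀ {a} {A : Set a} → List A → (A → Carrier) → Carrier
  sumOver L f = foldr _∙_ ε (map f L)

  syntax sumOver L (λ x → e) = ∑[ x ∈ L ] e

  module _ {a} {A : Set a} where
    ∑-cong : ∀ (L : List A) {f g : A → Carrier} → (∀ x → f x ≈ g x) → sumOver L f ≈ sumOver L g
    ∑-cong []      f≈g = refl
    ∑-cong (x ∷ L) f≈g = ∙-cong (f≈g x) (∑-cong L f≈g)

    ∑-++ : ∀ (L L′ : List A) f → sumOver (L ++ L′) f ≈ sumOver L f ∙ sumOver L′ f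
    ∑-++ []      L′ f = sym (identityˡ _)
    ∑-++ (x ∷ L) L′ f = trans (∙-congˡ (∑-++ L L′ f)) (sym (assoc _ _ _))

    ∑-zeros : ∀ (L : List A) {f} → (∀ x → f x ≈ ε) → sumOver L f ≈ ε
    ∑-zeros []      f≈ε = refl
    ∑-zeros (x ∷ L) f≈ε = trans (∙-cong (f≈ε x) (∑-zeros L f≈ε)) (identityˡ _)

    ∑-distrib-∙ : ∀ (L : List A) f g → (∑[ x ∈ L ] (f x ∙ g x)) ≈ sumOver L f ∙ sumOver L g
    ∑-distrib-∙ []      f g = sym (identityˡ _)
    ∑-distrib-∙ (x ∷ L) f g = trans (∙-congˡ (∑-distrib-∙ L f g)) (interchange _ _ _ _)
      where open import Algebra.Properties.CommutativeSemigroup commutativeSemigroup using (interchange)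

    ∑-filter : ∀ {p} {P : Pred A p} (P? : Decidable P) (L : List A) f →
               sumOver (filter P? L) f ≈ ∑[ x ∈ L ] (if does (P? x) then f x else ε)
    ∑-filter P? []      f = refl
    ∑-filter P? (x ∷ L) f with does (P? x)
    ... | true  = ∙-congˡ (∑-filter P? L f)
    ... | false = trans (∑-filter P? L f) (sym (identityˡ _))

    ∑-homomorphic : (h : Carrier → Carrier) → (∀ {x y} → x ≈ y → h x ≈ h y) → h ε ≈ ε →
                    (∀ x y → h (x ∙ y) ≈ h x ∙ h y) →
                    ∀ (L : List A) f → h (sumOver L f) ≈ sumOver L (h ∘ f)
    ∑-homomorphic h h-cong h-ε h-∙ []      f = h-ε
    ∑-homomorphic h h-cong h-ε h-∙ (x ∷ L) f = trans (h-∙ _ _) (∙-congˡ (∑-homomorphic h h-cong h-ε h-∙ L f))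

  ∑-map : ∀ {a b} {A : Set a} {B : Set b} (g : A → B) (L : List A) f → sumOver (map g L) f ≡ sumOver L (f ∘ g)
  ∑-map g []      f = ≡.refl
  ∑-map g (x ∷ L) f = ≡.cong (f (g x) ∙_) (∑-map g L f)

  ∑-concatMap : ∀ {a b} {A : Set a} {B : Set b} (h : A → List B) (L : List A) f →
                sumOver (concatMap h L) f ≈ ∑[ x ∈ L ] sumOver (h x) f
  ∑-concatMap h []      f = refl
  ∑-concatMap h (x ∷ L) f = trans (∑-++ (h x) (concatMap h L) f) (∙-congˡ (∑-concatMap h L f))

  ∑-comm : ∀ {a b} {A : Set a} {B : Set b} (L : List A) (L′ : List B) (f : A → B → Carrier) →
           (∑[ x ∈ L ] ∑[ y ∈ L′ ] f x y) ≈ (∑[ y ∈ L′ ] ∑[ x ∈ L ] f x y)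
  ∑-comm []      L′ f = sym (∑-zeros L′ (λ _ → refl))
  ∑-comm (x ∷ L) L′ f = trans (∙-congˡ (∑-comm L L′ f)) (sym (∑-distrib-∙ L′ (f x) _))

  ∑-comm² : ∀ {a b} {A : Set a} {B : Set b} (L₁ L₂ : List A) (L₃ L₄ : List B) (f : A → A → B → B → Carrier) →
            (∑[ x ∈ L₁ ] ∑[ y ∈ L₂ ] ∑[ z ∈ L₃ ] ∑[ t ∈ L₄ ] f x y z t) ≈
            (∑[ z ∈ L₃ ] ∑[ t ∈ L₄ ] ∑[ x ∈ L₁ ] ∑[ y ∈ L₂ ] f x y z t)
  ∑-comm² L₁ L₂ L₃ L₄ f = begin
    (∑[ x ∈ L₁ ] ∑[ y ∈ L₂ ] ∑[ z ∈ L₃ ] ∑[ t ∈ L₄ ] f x y z t)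
      ≈⟨ ∑-cong L₁ (λ x → ∑-comm L₂ L₃ _) ⟩
    (∑[ x ∈ L₁ ] ∑[ z ∈ L₃ ] ∑[ y ∈ L₂ ] ∑[ t ∈ L₄ ] f x y z t)
      ≈⟨ ∑-comm L₁ L₃ _ ⟩
    (∑[ z ∈ L₃ ] ∑[ x ∈ L₁ ] ∑[ y ∈ L₂ ] ∑[ t ∈ L₄ ] f x y z t)
      ≈⟨ ∑-cong L₃ (λ z → ∑-cong L₁ (λ x → ∑-comm L₂ L₄ _)) ⟩
    (∑[ z ∈ L₃ ] ∑[ x ∈ L₁ ] ∑[ t ∈ L₄ ] ∑[ y ∈ L₂ ] f x y z t)
      ≈⟨ ∑-cong L₃ (λ z → ∑-comm L₁ L₄ _) ⟩
    (∑[ z ∈ L₃ ] ∑[ t ∈ L₄ ] ∑[ x ∈ L₁ ] ∑[ y ∈ L₂ ] f x y z t)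
      ∎

  ∑-cartesianProduct : ∀ {a b} {A : Set a} {B : Set b} (L : List A) (L′ : List B) f →
                       sumOver (cartesianProduct L L′) f ≈ ∑[ x ∈ L ] ∑[ y ∈ L′ ] f (x , y)
  ∑-cartesianProduct []      L′ f = refl
  ∑-cartesianProduct (x ∷ L) L′ f = trans (∑-++ (map (x ,_) L′) (cartesianProduct L L′) f)
                                          (∙-cong (reflexive (∑-map (x ,_) L′ f)) (∑-cartesianProduct L L′ f))

  ∑-tabulate : ∀ {b} {B : Set b} {n} (g : Fin n → B) f → sumOver (tabulate g) f ≡ sumOver (allFin n) (f ∘ g)
  ∑-tabulate g f = ≡.cong (foldr _∙_ ε) (≡.trans (map-tabulate g f) (≡.sym (map-tabulate _ (f ∘ g))))

  ∑-lookup : ∀ {a} {A : Set a} (L : List A) f → sumOver (allFin (length L)) (f ∘ lookup L) ≡ sumOver L f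
  ∑-lookup L f = ≡.trans (≡.sym (∑-tabulate (lookup L) f)) (≡.cong (λ L′ → sumOver L′ f) (tabulate-lookup L))

  ∑-allFin-suc : ∀ {n} (f : Fin (suc n) → Carrier) →
                 sumOver (allFin (suc n)) f ≡ f fzero ∙ sumOver (allFin n) (f ∘ fsuc)
  ∑-allFin-suc f = ≡.cong (f fzero ∙_) (∑-tabulate fsuc f)

  ∑-allFin-select : ∀ {n} (i : Fin n) (f : Fin n → Carrier) → (∀ j → j ≢ i → f j ≈ ε) → sumOver (allFin n) f ≈ f i
  ∑-allFin-select {suc n} fzero f vanish = begin
    sumOver (allFin (suc n)) f               ≡⟨ ∑-allFin-suc f ⟩
    f fzero ∙ sumOver (allFin n) (f ∘ fsuc)  ≈⟨ ∙-congˡ (∑-zeros (allFin n) (λ j → vanish (fsuc j) (λ ()))) ⟩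
    f fzero ∙ ε                              ≈⟨ identityʳ _ ⟩
    f fzero                                  ∎
  ∑-allFin-select {suc n} (fsuc i) f vanish = begin
    sumOver (allFin (suc n)) f               ≡⟨ ∑-allFin-suc f ⟩
    f fzero ∙ sumOver (allFin n) (f ∘ fsuc)  ≈⟨ ∙-cong (vanish fzero (λ ())) (∑-allFin-select i (f ∘ fsuc) vanish′) ⟩
    ε ∙ f (fsuc i)                           ≈⟨ identityˡ _ ⟩
    f (fsuc i)                               ∎
    where
    vanish′ : ∀ j → j ≢ i → f (fsuc j) ≈ ε
    vanish′ j j≢i = vanish (fsuc j) (j≢i ∘ suc-injective)

module ℕ∑ = ListSum ℕP.+-0-commutativeMonoid

module _ where
  open ℕ∑
  open ≡.≡-Reasoning

  ∑-const : ∀ {a} {A : Set a} (L : List A) n → (∑[ _ ∈ L ] n) ≡ length L ℕ.* n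
  ∑-const []      n = ≡.refl
  ∑-const (x ∷ L) n = ≡.cong (n ℕ.+_) (∑-const L n)

  length-as-∑ : ∀ {a} {A : Set a} (L : List A) → (∑[ _ ∈ L ] 1) ≡ length L
  length-as-∑ L = ≡.trans (∑-const L 1) (ℕP.*-identityʳ (length L))

  ∑-suc : ∀ {a} {A : Set a} (L : List A) f → (∑[ x ∈ L ] suc (f x)) ≡ length L ℕ.+ sumOver L f
  ∑-suc L f = ≡.trans (∑-distrib-∙ L (λ _ → 1) f) (≡.cong (ℕ._+ sumOver L f) (length-as-∑ L))

  length-allFin : ∀ n → length (allFin n) ≡ n
  length-allFin n = length-tabulate id

  length-cartesianProduct : ∀ {a b} {A : Set a} {B : Set b} (L : List A) (L′ : List B) →
                            length (cartesianProduct L L′) ≡ length L ℕ.* length L′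
  length-cartesianProduct L L′ = begin
    length (cartesianProduct L L′)          ≡⟨ length-as-∑ (cartesianProduct L L′) ⟨
    (∑[ _ ∈ cartesianProduct L L′ ] 1)      ≡⟨ ∑-cartesianProduct L L′ (λ _ → 1) ⟩
    (∑[ _ ∈ L ] ∑[ _ ∈ L′ ] 1)              ≡⟨ ∑-cong L (λ _ → length-as-∑ L′) ⟩
    (∑[ _ ∈ L ] length L′)                  ≡⟨ ∑-const L (length L′) ⟩
    length L ℕ.* length L′                  ∎

  ∑-length-filter-≟ : ∀ {a} {A : Set a} {m} (s : A → Fin m) (L : List A) →
                       (∑[ c ∈ allFin m ] length (filter (λ x → s x ≟ᶠ c) L)) ≡ length L
  ∑-length-filter-≟ {m = m} s L = begin
    (∑[ c ∈ allFin m ] length (filter (λ x → s x ≟ᶠ c) L))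
      ≡⟨ ∑-cong (allFin m) (λ c → length-as-∑ (filter (λ x → s x ≟ᶠ c) L)) ⟨
    (∑[ c ∈ allFin m ] ∑[ _ ∈ filter (λ x → s x ≟ᶠ c) L ] 1)
      ≡⟨ ∑-cong (allFin m) (λ c → ∑-filter (λ x → s x ≟ᶠ c) L (λ _ → 1)) ⟩
    (∑[ c ∈ allFin m ] ∑[ x ∈ L ] indicator (s x) c)
      ≡⟨ ∑-comm (allFin m) L (λ c x → indicator (s x) c) ⟩
    (∑[ x ∈ L ] ∑[ c ∈ allFin m ] indicator (s x) c)
      ≡⟨ ∑-cong L (λ x → ∑-allFin-select (s x) (indicator (s x)) (indicator-≢ (s x))) ⟩
    (∑[ x ∈ L ] indicator (s x) (s x))
      ≡⟨ ∑-cong L (λ x → ≡.cong (if_then 1 else 0) (dec-true (s x ≟ᶠ s x) ≡.refl)) ⟩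
    (∑[ _ ∈ L ] 1)
      ≡⟨ length-as-∑ L ⟩
    length L
      ∎
    where
    indicator : Fin m → Fin m → ℕ
    indicator a c = if does (a ≟ᶠ c) then 1 else 0
    indicator-≢ : ∀ a c → c ≢ a → indicator a c ≡ 0
    indicator-≢ a c c≢a = ≡.cong (if_then 1 else 0) (dec-false (a ≟ᶠ c) (c≢a ∘ ≡.sym))

module NCPolynomials {c ℓ} (F : Field c ℓ) where
  open Field F
  open Poly F

  +P-commutativeMonoid : ℕ → CommutativeMonoid c ℓ
  +P-commutativeMonoid m = record
    { Carrier = NCPoly m
    ; _≈_ = _≋_
    ; _∙_ = _+P_
    ; ε = 0P
    ; isCommutativeMonoid = record
      { isMonoid = record
        { isSemigroup = record
          { isMagma = record
            { isEquivalence = record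
              { refl = λ w → refl ; sym = λ p≋q w → sym (p≋q w) ; trans = λ p≋q q≋r w → trans (p≋q w) (q≋r w) }
            ; ∙-cong = λ p≋p′ q≋q′ w → +-cong (p≋p′ w) (q≋q′ w) }
          ; assoc = λ p q r w → +-assoc (p w) (q w) (r w) }
        ; identity = (λ p w → +-identityˡ (p w)) , (λ p w → +-identityʳ (p w)) }
      ; comm = λ p q w → +-comm (p w) (q w) } }

  ∂ : ∀ {m} → Fin m → NCPoly m → NCPoly m
  ∂ a p w = p (a ∷ w)

  module _ {m : ℕ} where
    open ListSum +-commutativeMonoid using (sumOver; ∑-cong; ∑-zeros; ∑-distrib-∙)
    open ≈-Reasoning setoid

    *P-as-∑ : ∀ (p q : NCPoly m) w → (p *P q) w ≡ ∑[ s ∈ splits w ] (p (proj₁ s) * q (proj₂ s))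
    *P-as-∑ p q w = ≡.sym (foldr-map _+_ _ 0# (splits w))

    *P-∷ : ∀ (p q : NCPoly m) a w → (p *P q) (a ∷ w) ≡ p [] * q (a ∷ w) + (∂ a p *P q) w
    *P-∷ p q a w = ≡.cong (p [] * q (a ∷ w) +_) (foldr-map _ _ 0# (splits w))

    *P-cong : ∀ {p p′ q q′ : NCPoly m} → p ≋ p′ → q ≋ q′ → (p *P q) ≋ (p′ *P q′)
    *P-cong {p} {p′} {q} {q′} p≋p′ q≋q′ w = begin
      (p *P q) w                                        ≡⟨ *P-as-∑ p q w ⟩
      (∑[ s ∈ splits w ] (p (proj₁ s) * q (proj₂ s)))    ≈⟨ ∑-cong (splits w) (λ s → *-cong (p≋p′ _) (q≋q′ _)) ⟩
      (∑[ s ∈ splits w ] (p′ (proj₁ s) * q′ (proj₂ s)))  ≡⟨ *P-as-∑ p′ q′ w ⟨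
      (p′ *P q′) w                                      ∎

    *P-distribʳ : ∀ (p p′ q : NCPoly m) → ((p +P p′) *P q) ≋ ((p *P q) +P (p′ *P q))
    *P-distribʳ p p′ q w = begin
      ((p +P p′) *P q) w
        ≡⟨ *P-as-∑ (p +P p′) q w ⟩
      (∑[ s ∈ splits w ] ((p (proj₁ s) + p′ (proj₁ s)) * q (proj₂ s)))
        ≈⟨ ∑-cong (splits w) (λ s → distribʳ _ _ _) ⟩
      (∑[ s ∈ splits w ] (p (proj₁ s) * q (proj₂ s) + p′ (proj₁ s) * q (proj₂ s)))
        ≈⟨ ∑-distrib-∙ (splits w) _ _ ⟩
      (∑[ s ∈ splits w ] (p (proj₁ s) * q (proj₂ s))) + (∑[ s ∈ splits w ] (p′ (proj₁ s) * q (proj₂ s)))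
        ≡⟨ ≡.cong₂ _+_ (*P-as-∑ p q w) (*P-as-∑ p′ q w) ⟨
      ((p *P q) +P (p′ *P q)) w
        ∎

    *P-distribˡ : ∀ (p q q′ : NCPoly m) → (p *P (q +P q′)) ≋ ((p *P q) +P (p *P q′))
    *P-distribˡ p q q′ w = begin
      (p *P (q +P q′)) w
        ≡⟨ *P-as-∑ p (q +P q′) w ⟩
      (∑[ s ∈ splits w ] (p (proj₁ s) * (q (proj₂ s) + q′ (proj₂ s))))
        ≈⟨ ∑-cong (splits w) (λ s → distribˡ _ _ _) ⟩
      (∑[ s ∈ splits w ] (p (proj₁ s) * q (proj₂ s) + p (proj₁ s) * q′ (proj₂ s)))
        ≈⟨ ∑-distrib-∙ (splits w) _ _ ⟩
      (∑[ s ∈ splits w ] (p (proj₁ s) * q (proj₂ s))) + (∑[ s ∈ splits w ] (p (proj₁ s) * q′ (proj₂ s)))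
        ≡⟨ ≡.cong₂ _+_ (*P-as-∑ p q w) (*P-as-∑ p q′ w) ⟨
      ((p *P q) +P (p *P q′)) w
        ∎

    *P-zeroˡ : ∀ (q : NCPoly m) → (0P *P q) ≋ 0P
    *P-zeroˡ q w = trans (reflexive (*P-as-∑ 0P q w)) (∑-zeros (splits w) (λ _ → zeroˡ _))

    *P-zeroʳ : ∀ (p : NCPoly m) → (p *P 0P) ≋ 0P
    *P-zeroʳ p w = trans (reflexive (*P-as-∑ p 0P w)) (∑-zeros (splits w) (λ _ → zeroʳ _))

    *P-identityˡ : ∀ (q : NCPoly m) → (1P *P q) ≋ q
    *P-identityˡ q []      = trans (+-identityʳ _) (*-identityˡ _)
    *P-identityˡ q (a ∷ w) = begin
      (1P *P q) (a ∷ w)             ≡⟨ *P-∷ 1P q a w ⟩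
      1# * q (a ∷ w) + (0P *P q) w  ≈⟨ +-cong (*-identityˡ _) (*P-zeroˡ q w) ⟩
      q (a ∷ w) + 0#                ≈⟨ +-identityʳ _ ⟩
      q (a ∷ w)                     ∎

    *P-identityʳ : ∀ (p : NCPoly m) → (p *P 1P) ≋ p
    *P-identityʳ p []      = trans (+-identityʳ _) (*-identityʳ _)
    *P-identityʳ p (a ∷ w) = begin
      (p *P 1P) (a ∷ w)            ≡⟨ *P-∷ p 1P a w ⟩
      p [] * 0# + (∂ a p *P 1P) w  ≈⟨ +-cong (zeroʳ _) (*P-identityʳ (∂ a p) w) ⟩
      0# + p (a ∷ w)               ≈⟨ +-identityˡ _ ⟩
      p (a ∷ w)                    ∎

    ∂-*P : ∀ (p q : NCPoly m) a w → p [] ≈ 0# → (p *P q) (a ∷ w) ≈ (∂ a p *P q) w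
    ∂-*P p q a w p[]≈0 = begin
      (p *P q) (a ∷ w)                   ≡⟨ *P-∷ p q a w ⟩
      p [] * q (a ∷ w) + (∂ a p *P q) w  ≈⟨ +-congʳ (trans (*-congʳ p[]≈0) (zeroˡ _)) ⟩
      0# + (∂ a p *P q) w                ≈⟨ +-identityˡ _ ⟩
      (∂ a p *P q) w                     ∎

    monoP-≡ : ∀ (u : Word m) → monoP u u ≈ 1#
    monoP-≡ u = reflexive (≡.cong (if_then 1# else 0#) (dec-true (≡-dec _≟ᶠ_ u u) ≡.refl))

    monoP-≢ : ∀ (u w : Word m) → u ≢ w → monoP u w ≈ 0#
    monoP-≢ u w u≢w = reflexive (≡.cong (if_then 1# else 0#) (dec-false (≡-dec _≟ᶠ_ u w) u≢w))

    1P≋monoP[] : 1P ≋ monoP {m} []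
    1P≋monoP[] []      = sym (monoP-≡ [])
    1P≋monoP[] (a ∷ w) = sym (monoP-≢ [] (a ∷ w) λ ())

    ∂-monoP-≡ : ∀ a (u : Word m) → ∂ a (monoP (a ∷ u)) ≋ monoP u
    ∂-monoP-≡ a u w = by-cases (≡-dec _≟ᶠ_ u w)
      where
      by-cases : Dec (u ≡ w) → monoP (a ∷ u) (a ∷ w) ≈ monoP u w
      by-cases (yes ≡.refl) = trans (monoP-≡ (a ∷ u)) (sym (monoP-≡ u))
      by-cases (no u≢w)     = trans (monoP-≢ (a ∷ u) (a ∷ w) (u≢w ∘ ∷-injectiveʳ)) (sym (monoP-≢ u w u≢w))

    ∂-monoP-≢ : ∀ {a b} (u : Word m) → a ≢ b → ∂ a (monoP (b ∷ u)) ≋ 0P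
    ∂-monoP-≢ {a} {b} u a≢b w = monoP-≢ (b ∷ u) (a ∷ w) (a≢b ∘ ≡.sym ∘ ∷-injectiveˡ)

    monoP-*P : ∀ (u v : Word m) → (monoP u *P monoP v) ≋ monoP (u ++ v)
    monoP-*P []      v w       = trans (*P-cong (sym ∘ 1P≋monoP[]) (λ _ → refl) w) (*P-identityˡ (monoP v) w)
    monoP-*P (b ∷ u) v []      = begin
      monoP (b ∷ u) [] * monoP v [] + 0#  ≈⟨ +-identityʳ _ ⟩
      monoP (b ∷ u) [] * monoP v []       ≈⟨ *-congʳ (monoP-≢ (b ∷ u) [] λ ()) ⟩
      0# * monoP v []                     ≈⟨ zeroˡ _ ⟩
      0#                                  ≈⟨ monoP-≢ (b ∷ u ++ v) [] (λ ()) ⟨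
      monoP (b ∷ u ++ v) []               ∎
    monoP-*P (b ∷ u) v (a ∷ w) = trans (∂-*P (monoP (b ∷ u)) (monoP v) a w (monoP-≢ (b ∷ u) [] λ ())) (by-cases (a ≟ᶠ b))
      where
      by-cases : Dec (a ≡ b) → (∂ a (monoP (b ∷ u)) *P monoP v) w ≈ ∂ a (monoP (b ∷ u ++ v)) w
      by-cases (yes ≡.refl) = trans (*P-cong (∂-monoP-≡ a u) (λ _ → refl) w)
                                    (trans (monoP-*P u v w) (sym (∂-monoP-≡ a (u ++ v) w)))
      by-cases (no a≢b)     = trans (*P-cong (∂-monoP-≢ u a≢b) (λ _ → refl) w)
                                    (trans (*P-zeroˡ (monoP v) w) (sym (∂-monoP-≢ (u ++ v) a≢b w)))

    monoP-node : ∀ (u : Word m) x v → (monoP u *P (varP x *P monoP v)) ≋ monoP (u ++ x ∷ v)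
    monoP-node u x v w = trans (*P-cong (λ _ → refl) (monoP-*P (x ∷ []) v) w) (monoP-*P u (x ∷ v) w)

  module _ {m : ℕ} where
    open CommutativeMonoid (+P-commutativeMonoid m) using () renaming (refl to ≋-refl)
    open ListSum (+P-commutativeMonoid m) using (sumOver; ∑-homomorphic)

    *P-∑ˡ : ∀ {a} {A : Set a} (L : List A) f (q : NCPoly m) → (sumOver L f *P q) ≋ (∑[ y ∈ L ] (f y *P q))
    *P-∑ˡ L f q = ∑-homomorphic (_*P q) (λ p≋p′ → *P-cong p≋p′ ≋-refl) (*P-zeroˡ q) (λ p p′ → *P-distribʳ p p′ q) L f

    *P-∑ʳ : ∀ {a} {A : Set a} (L : List A) f (p : NCPoly m) → (p *P sumOver L f) ≋ (∑[ y ∈ L ] (p *P f y))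
    *P-∑ʳ L f p = ∑-homomorphic (p *P_) (*P-cong ≋-refl) (*P-zeroʳ p) (*P-distribˡ p) L f

module Circuits {c ℓ} (F : Field c ℓ) where
  open Field F using (refl; trans; reflexive)
  open Poly F
  open NCPolynomials F

  module _ {m : ℕ} where
    open ListSum (+P-commutativeMonoid m) using (∑-cong)
    open ℕ∑ using (sumOver)

    renameGate : ∀ {k k′} → (Fin k → Fin k′) → Gate m k → Gate m k′
    renameGate ρ (var x)   = var x
    renameGate ρ (const a) = const a
    renameGate ρ (add js)  = add (map ρ js)
    renameGate ρ (mul js)  = mul (map ρ js)

    extend : ∀ {k} n → (Fin n → Gate m k) → Circuit m k → Circuit m (n ℕ.+ k)
    extend zero    gates C = C
    extend (suc n) gates C = renameGate (n ↑ʳ_) (gates fzero) ∷ extend n (gates ∘ fsuc) C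

    prodP-cong : ∀ {k} (js : List (Fin k)) {v v′ : Fin k → NCPoly m} →
                 (∀ i → v i ≋ v′ i) → prodP (map v js) ≋ prodP (map v′ js)
    prodP-cong []       v≋v′ w = refl
    prodP-cong (j ∷ js) v≋v′   = *P-cong (v≋v′ j) (prodP-cong js v≋v′)

    evalGate-cong : ∀ {k} (g : Gate m k) {v v′} → (∀ i → v i ≋ v′ i) → evalGate g v ≋ evalGate g v′
    evalGate-cong (var x)   v≋v′ w = refl
    evalGate-cong (const a) v≋v′ w = refl
    evalGate-cong (add js)  v≋v′   = ∑-cong js v≋v′
    evalGate-cong (mul js)  v≋v′   = prodP-cong js v≋v′

    evalGate-rename : ∀ {k k′} (ρ : Fin k → Fin k′) (g : Gate m k) v →
                      evalGate (renameGate ρ g) v ≡ evalGate g (v ∘ ρ)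
    evalGate-rename ρ (var x)   v = ≡.refl
    evalGate-rename ρ (const a) v = ≡.refl
    evalGate-rename ρ (add js)  v = ≡.cong sumP (≡.sym (map-∘ js))
    evalGate-rename ρ (mul js)  v = ≡.cong prodP (≡.sym (map-∘ js))

    eval-extend-old : ∀ {k} n gates (C : Circuit m k) i → eval (extend n gates C) (n ↑ʳ i) ≡ eval C i
    eval-extend-old zero    gates C i = ≡.refl
    eval-extend-old (suc n) gates C i = eval-extend-old n (gates ∘ fsuc) C i

    eval-extend-new : ∀ {k} n gates (C : Circuit m k) i →
                      eval (extend n gates C) (i ↑ˡ k) ≋ evalGate (gates i) (eval C)
    eval-extend-new (suc n) gates C fzero w = trans
      (reflexive (≡.cong-app (evalGate-rename (n ↑ʳ_) (gates fzero) _) w))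
      (evalGate-cong (gates fzero) (λ i → reflexive ∘ ≡.cong-app (eval-extend-old n (gates ∘ fsuc) C i)) w)
    eval-extend-new (suc n) gates C (fsuc i) = eval-extend-new n (gates ∘ fsuc) C i

    UniqueShape : ∀ {k} → Circuit m k → Fin k → Shape → Set c
    UniqueShape C i s = ∀ {t} → HasParseTree C i t → t ≡ s

    data ShapedGate {k} (C : Circuit m k) : Gate m k → Shape → Set c where
      var-shaped : ∀ x → ShapedGate C (var x) leafS
      add-shaped : ∀ {js s} → All (λ j → UniqueShape C j s) js → ShapedGate C (add js) (addS s)
      mul-shaped : ∀ {js ss} → Pointwise (UniqueShape C) js ss → ShapedGate C (mul js) (mulS ss)

    uniqueShape-there : ∀ {k} {g : Gate m k} {C i s} →
                        UniqueShape C i s → UniqueShape (g ∷ C) (fsuc i) s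
    uniqueShape-there shape (there tree) = shape tree

    uniqueShape-top : ∀ {k} {C : Circuit m k} {g s} → ShapedGate C g s → UniqueShape (g ∷ C) fzero s
    uniqueShape-top (var-shaped x)      (varT .x)    = ≡.refl
    uniqueShape-top (add-shaped shapes) (addT tree)  =
      let (shape , childTree) = All.lookupAny shapes tree in ≡.cong addS (shape childTree)
    uniqueShape-top (mul-shaped shapes) (mulT trees) = ≡.cong mulS (children shapes trees)
      where
      children : ∀ {k} {C : Circuit m k} {js ss ts} →
                 Pointwise (UniqueShape C) js ss → Pointwise (HasParseTree C) js ts → ts ≡ ss
      children []       []       = ≡.refl
      children (s ∷ ss) (t ∷ ts) = ≡.cong₂ _∷_ (s t) (children ss ts)

    uniqueShape⇒UPT : ∀ {k} {C : Circuit m (suc k)} {s} → UniqueShape C fzero s → UPT C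
    uniqueShape⇒UPT shape tree tree′ = ≡.trans (shape tree) (≡.sym (shape tree′))

    shapedGate-rename : ∀ {k k′} {C : Circuit m k} {C′ : Circuit m k′} (ρ : Fin k → Fin k′) →
                        (∀ {j s} → UniqueShape C j s → UniqueShape C′ (ρ j) s) →
                        ∀ {g s} → ShapedGate C g s → ShapedGate C′ (renameGate ρ g) s
    shapedGate-rename ρ transport (var-shaped x)      = var-shaped x
    shapedGate-rename ρ transport (add-shaped shapes) = add-shaped (gmap⁺ transport shapes)
    shapedGate-rename ρ transport (mul-shaped shapes) = mul-shaped (children shapes)
      where
      children : ∀ {js ss} → Pointwise (UniqueShape _) js ss → Pointwise (UniqueShape _) (map ρ js) ss
      children []       = []
      children (s ∷ ss) = transport s ∷ children ss

    uniqueShape-extend-old : ∀ {k} n gates (C : Circuit m k) {i s} →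
                             UniqueShape C i s → UniqueShape (extend n gates C) (n ↑ʳ i) s
    uniqueShape-extend-old zero    gates C shape = shape
    uniqueShape-extend-old (suc n) gates C shape =
      uniqueShape-there (uniqueShape-extend-old n (gates ∘ fsuc) C shape)

    uniqueShape-extend-new : ∀ {k} n gates (C : Circuit m k) i {s} →
                             ShapedGate C (gates i) s → UniqueShape (extend n gates C) (i ↑ˡ k) s
    uniqueShape-extend-new (suc n) gates C fzero shaped =
      uniqueShape-top (shapedGate-rename (n ↑ʳ_) (uniqueShape-extend-old n (gates ∘ fsuc) C) shaped)
    uniqueShape-extend-new (suc n) gates C (fsuc i) shaped =
      uniqueShape-there (uniqueShape-extend-new n (gates ∘ fsuc) C i shaped)

    fanIn-rename : ∀ {k k′} (ρ : Fin k → Fin k′) (g : Gate m k) → fanIn (renameGate ρ g) ≡ fanIn g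
    fanIn-rename ρ (var x)   = ≡.refl
    fanIn-rename ρ (const a) = ≡.refl
    fanIn-rename ρ (add js)  = length-map ρ js
    fanIn-rename ρ (mul js)  = length-map ρ js

    size-extend : ∀ {k} n gates (C : Circuit m k) →
                  size (extend n gates C) ≡ ∑[ i ∈ allFin n ] suc (fanIn (gates i)) ℕ.+ size C
    size-extend zero    gates C = ≡.refl
    size-extend (suc n) gates C = begin
      suc (fanIn (renameGate (n ↑ʳ_) (gates fzero)) ℕ.+ size (extend n (gates ∘ fsuc) C))
        ≡⟨ ≡.cong suc (≡.cong₂ ℕ._+_ (fanIn-rename (n ↑ʳ_) (gates fzero)) (size-extend n (gates ∘ fsuc) C)) ⟩
      suc (fanIn (gates fzero) ℕ.+ (∑[ i ∈ allFin n ] suc (fanIn (gates (fsuc i))) ℕ.+ size C))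
        ≡⟨ ≡.cong suc (ℕP.+-assoc (fanIn (gates fzero)) _ (size C)) ⟨
      suc (fanIn (gates fzero)) ℕ.+ ∑[ i ∈ allFin n ] suc (fanIn (gates (fsuc i))) ℕ.+ size C
        ≡⟨ ≡.cong (ℕ._+ size C) (ℕ∑.∑-allFin-suc (λ i → suc (fanIn (gates i)))) ⟨
      ∑[ i ∈ allFin (suc n) ] suc (fanIn (gates i)) ℕ.+ size C
        ∎
      where open ≡.≡-Reasoning


module LegalColourings {c ℓ} (F : Field c ℓ) (m : ℕ) .{{_ : NonZero m}} where
  open Poly F
  open NCPolynomials F
  open CommutativeMonoid (+P-commutativeMonoid m) using (setoid; refl; sym; trans; reflexive)
  open ListSum (+P-commutativeMonoid m)
  open ≈-Reasoning setoid

  _⊕_ : Fin m → Fin m → Fin m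
  a ⊕ b = a +[ m ] b

  colourPairs : List (Fin m × Fin m)
  colourPairs = cartesianProduct (allFin m) (allFin m)

  when : Bool → NCPoly m → NCPoly m
  when b p = if b then p else 0P

  when-0P : ∀ b → when b 0P ≡ 0P
  when-0P true  = ≡.refl
  when-0P false = ≡.refl

  when-cong : ∀ b {p q} → p ≋ q → when b p ≋ when b q
  when-cong true  p≋q = p≋q
  when-cong false p≋q = refl

  when-∑ : ∀ {a} {A : Set a} b (L : List A) f → when b (sumOver L f) ≋ (∑[ x ∈ L ] when b (f x))
  when-∑ true  L f = refl
  when-∑ false L f = sym (∑-zeros L (λ _ → refl))

  when-nested : ∀ s ll lr p → when s (when ll (when lr p)) ≡ when ((ll ∧ lr) ∧ s) p
  when-nested s true  true  p = ≡.refl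
  when-nested s true  false p = when-0P s
  when-nested s false lr    p = when-0P s

  when-*P-when : ∀ α β (u : Word m) x v →
                 (when α (monoP u) *P (varP x *P when β (monoP v))) ≋ when α (when β (monoP (u ++ x ∷ v)))
  when-*P-when false β     u x v = *P-zeroˡ _
  when-*P-when true  false u x v = trans (*P-cong refl (*P-zeroʳ (varP x))) (*P-zeroʳ _)
  when-*P-when true  true  u x v = monoP-node u x v

  ifLegalRoot : ∀ {d} → Fin m → Colouring m d → NCPoly m → NCPoly m
  ifLegalRoot x γ = when (legal γ ∧ does (rootColour γ ≟ᶠ x))

  ifLegalRoot-≢ : ∀ {d} {x} (γ : Colouring m d) p → rootColour γ ≢ x → ifLegalRoot x γ p ≡ 0P
  ifLegalRoot-≢ {x = x} γ p ρ≢x = ≡.cong (λ b → when b p)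
    (≡.trans (≡.cong (legal γ ∧_) (dec-false (rootColour γ ≟ᶠ x) ρ≢x)) (∧-zeroʳ (legal γ)))

  ifLegalRoot-≡ : ∀ {d} (γ : Colouring m d) p → ifLegalRoot (rootColour γ) γ p ≡ when (legal γ) p
  ifLegalRoot-≡ γ p = ≡.cong (λ b → when b p)
    (≡.trans (≡.cong (legal γ ∧_) (dec-true (rootColour γ ≟ᶠ rootColour γ) ≡.refl)) (∧-identityʳ (legal γ)))

  Proot : ℕ → Fin m → NCPoly m
  Proot d x = ∑[ γ ∈ allColourings m d ] ifLegalRoot x γ (monoP (inorder γ))

  P≋∑Proot : ∀ d → P m d ≋ (∑[ x ∈ allFin m ] Proot d x)
  P≋∑Proot d = begin
    P m d
      ≈⟨ ∑-filter (λ γ → legal γ Bool.≟ true) colourings mono ⟩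
    (∑[ γ ∈ colourings ] when (does (legal γ Bool.≟ true)) (mono γ))
      ≈⟨ ∑-cong colourings (λ γ → sym (select-root γ)) ⟩
    (∑[ γ ∈ colourings ] ∑[ x ∈ allFin m ] ifLegalRoot x γ (mono γ))
      ≈⟨ ∑-comm colourings (allFin m) _ ⟩
    (∑[ x ∈ allFin m ] Proot d x)
      ∎
    where
    colourings = allColourings m d
    mono = monoP ∘ inorder
    does-≟-true : ∀ b → b ≡ does (b Bool.≟ true)
    does-≟-true true  = ≡.refl
    does-≟-true false = ≡.refl
    select-root : ∀ γ → (∑[ x ∈ allFin m ] ifLegalRoot x γ (mono γ)) ≋ when (does (legal γ Bool.≟ true)) (mono γ)
    select-root γ = trans
      (∑-allFin-select (rootColour γ) (λ x → ifLegalRoot x γ (mono γ))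
                       (λ x x≢ρ → reflexive (ifLegalRoot-≢ γ (mono γ) (x≢ρ ∘ ≡.sym))))
      (reflexive (≡.trans (ifLegalRoot-≡ γ (mono γ)) (≡.cong (λ b → when b (mono γ)) (does-≟-true (legal γ)))))

  Proot-zero : ∀ x → Proot 0 x ≋ varP x
  Proot-zero x = begin
    Proot 0 x                                            ≡⟨ ∑-map leaf (allFin m) _ ⟩
    (∑[ c ∈ allFin m ] ifLegalRoot x (leaf c) (varP c))  ≈⟨ ∑-allFin-select x _ off-x ⟩
    ifLegalRoot x (leaf x) (varP x)                      ≡⟨ ifLegalRoot-≡ (leaf x) (varP x) ⟩
    varP x                                               ∎
    where
    off-x : ∀ c → c ≢ x → ifLegalRoot x (leaf c) (varP c) ≋ 0P
    off-x c c≢x = reflexive (ifLegalRoot-≢ (leaf c) (varP c) c≢x)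

  -- The trailing 1P is how prodP closes the product of a fan-in 3 product gate.
  Pjoin : ℕ → Fin m × Fin m → NCPoly m
  Pjoin d (a , b) = Proot d a *P (varP (a ⊕ b) *P (Proot d b *P 1P))

  joinTerm : ∀ {d} → Fin m → Colouring m d → Colouring m d → NCPoly m
  joinTerm x l r = when ((legal l ∧ legal r) ∧ does (s ≟ᶠ x)) (monoP (inorder l ++ s ∷ inorder r))
    where s = rootColour l ⊕ rootColour r

  module _ {d : ℕ} where
    private colourings = allColourings m d

    Pjoin-expand : ∀ a b → Pjoin d (a , b) ≋
      (∑[ l ∈ colourings ] ∑[ r ∈ colourings ] ifLegalRoot a l (ifLegalRoot b r (monoP (inorder l ++ (a ⊕ b) ∷ inorder r))))
    Pjoin-expand a b = begin
      Pjoin d (a , b)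
        ≈⟨ *P-cong refl (*P-cong refl (*P-identityʳ (Proot d b))) ⟩
      Proot d a *P (varP (a ⊕ b) *P Proot d b)
        ≈⟨ *P-∑ˡ colourings (term a) _ ⟩
      (∑[ l ∈ colourings ] (term a l *P (varP (a ⊕ b) *P Proot d b)))
        ≈⟨ ∑-cong colourings (λ l → *P-cong refl (*P-∑ʳ colourings (term b) (varP (a ⊕ b)))) ⟩
      (∑[ l ∈ colourings ] (term a l *P (∑[ r ∈ colourings ] (varP (a ⊕ b) *P term b r))))
        ≈⟨ ∑-cong colourings (λ l → *P-∑ʳ colourings _ (term a l)) ⟩
      (∑[ l ∈ colourings ] ∑[ r ∈ colourings ] (term a l *P (varP (a ⊕ b) *P term b r)))
        ≈⟨ ∑-cong colourings (λ l → ∑-cong colourings (λ r →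
             when-*P-when (legal l ∧ does (rootColour l ≟ᶠ a)) (legal r ∧ does (rootColour r ≟ᶠ b))
                          (inorder l) (a ⊕ b) (inorder r))) ⟩
      (∑[ l ∈ colourings ] ∑[ r ∈ colourings ] ifLegalRoot a l (ifLegalRoot b r (monoP (inorder l ++ (a ⊕ b) ∷ inorder r))))
        ∎
      where
      term : Fin m → Colouring m d → NCPoly m
      term x γ = ifLegalRoot x γ (monoP (inorder γ))

    module _ (x : Fin m) (l r : Colouring m d) where
      private
        ρl = rootColour l
        ρr = rootColour r
        s  = ρl ⊕ ρr

      joinMonomial : Fin m → NCPoly m
      joinMonomial c = monoP (inorder l ++ c ∷ inorder r)

      ∑-rootColour-node : (∑[ c ∈ allFin m ] ifLegalRoot x (node l c r) (monoP (inorder (node l c r)))) ≋ joinTerm x l r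
      ∑-rootColour-node = trans
        (∑-allFin-select s _ (λ c c≢s → reflexive (≡.cong (λ e → nodeTerm e c) (dec-false (c ≟ᶠ s) c≢s))))
        (reflexive (≡.cong (λ e → nodeTerm e s) (dec-true (s ≟ᶠ s) ≡.refl)))
        where
        -- legal (node l c r) unfolds to does (c ≟ᶠ s) ∧ legal l ∧ legal r
        nodeTerm : Bool → Fin m → NCPoly m
        nodeTerm e c = when ((e ∧ legal l ∧ legal r) ∧ does (c ≟ᶠ x)) (joinMonomial c)

      guardedJoin : Fin m → Fin m → NCPoly m
      guardedJoin a b = when (does (a ⊕ b ≟ᶠ x)) (ifLegalRoot a l (ifLegalRoot b r (joinMonomial (a ⊕ b))))

      ∑-guardedJoin : (∑[ a ∈ allFin m ] ∑[ b ∈ allFin m ] guardedJoin a b) ≋ joinTerm x l r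
      ∑-guardedJoin = begin
        (∑[ a ∈ allFin m ] ∑[ b ∈ allFin m ] guardedJoin a b)
          ≈⟨ ∑-cong (allFin m) (λ a → ∑-allFin-select ρr (guardedJoin a) (off-ρr a)) ⟩
        (∑[ a ∈ allFin m ] guardedJoin a ρr)
          ≈⟨ ∑-allFin-select ρl (λ a → guardedJoin a ρr) off-ρl ⟩
        guardedJoin ρl ρr
          ≡⟨ ≡.cong (when g) (≡.trans (ifLegalRoot-≡ l _) (≡.cong (when (legal l)) (ifLegalRoot-≡ r _))) ⟩
        when g (when (legal l) (when (legal r) (joinMonomial s)))
          ≡⟨ when-nested g (legal l) (legal r) (joinMonomial s) ⟩
        joinTerm x l r
          ∎
        where
        g = does (s ≟ᶠ x)
        off-ρr : ∀ a b → b ≢ ρr → guardedJoin a b ≋ 0P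
        off-ρr a b b≢ρ = reflexive (≡.trans
          (≡.cong (λ p → when (does (a ⊕ b ≟ᶠ x)) (ifLegalRoot a l p)) (ifLegalRoot-≢ r _ (b≢ρ ∘ ≡.sym)))
          (≡.trans (≡.cong (when (does (a ⊕ b ≟ᶠ x))) (when-0P (legal l ∧ does (ρl ≟ᶠ a))))
                   (when-0P (does (a ⊕ b ≟ᶠ x)))))
        off-ρl : ∀ a → a ≢ ρl → guardedJoin a ρr ≋ 0P
        off-ρl a a≢ρ = reflexive (≡.trans
          (≡.cong (when (does (a ⊕ ρr ≟ᶠ x))) (ifLegalRoot-≢ l _ (a≢ρ ∘ ≡.sym)))
          (when-0P (does (a ⊕ ρr ≟ᶠ x))))

    Proot-suc-as-joins : ∀ x → Proot (suc d) x ≋ (∑[ l ∈ colourings ] ∑[ r ∈ colourings ] joinTerm x l r)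
    Proot-suc-as-joins x = begin
      Proot (suc d) x
        ≈⟨ ∑-concatMap _ colourings term ⟩
      (∑[ l ∈ colourings ] sumOver (concatMap (λ c → map (node l c) colourings) (allFin m)) term)
        ≈⟨ ∑-cong colourings (λ l → trans (∑-concatMap _ (allFin m) term)
                                          (∑-cong (allFin m) (λ c → reflexive (∑-map (node l c) colourings term)))) ⟩
      (∑[ l ∈ colourings ] ∑[ c ∈ allFin m ] ∑[ r ∈ colourings ] term (node l c r))
        ≈⟨ ∑-cong colourings (λ l → ∑-comm (allFin m) colourings _) ⟩
      (∑[ l ∈ colourings ] ∑[ r ∈ colourings ] ∑[ c ∈ allFin m ] term (node l c r))
        ≈⟨ ∑-cong colourings (λ l → ∑-cong colourings (∑-rootColour-node x l)) ⟩
      (∑[ l ∈ colourings ] ∑[ r ∈ colourings ] joinTerm x l r)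
        ∎
      where
      term : Colouring m (suc d) → NCPoly m
      term γ = ifLegalRoot x γ (monoP (inorder γ))

    ∑-Pjoin-as-joins : ∀ x → (∑[ p ∈ colourPairs ] when (does (proj₁ p ⊕ proj₂ p ≟ᶠ x)) (Pjoin d p)) ≋
                             (∑[ l ∈ colourings ] ∑[ r ∈ colourings ] joinTerm x l r)
    ∑-Pjoin-as-joins x = begin
      (∑[ p ∈ colourPairs ] when (does (proj₁ p ⊕ proj₂ p ≟ᶠ x)) (Pjoin d p))
        ≈⟨ ∑-cartesianProduct (allFin m) (allFin m) _ ⟩
      (∑[ a ∈ allFin m ] ∑[ b ∈ allFin m ] when (does (a ⊕ b ≟ᶠ x)) (Pjoin d (a , b)))
        ≈⟨ ∑-cong (allFin m) (λ a → ∑-cong (allFin m) (expand a)) ⟩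
      (∑[ a ∈ allFin m ] ∑[ b ∈ allFin m ] ∑[ l ∈ colourings ] ∑[ r ∈ colourings ] guardedJoin x l r a b)
        ≈⟨ ∑-comm² (allFin m) (allFin m) colourings colourings _ ⟩
      (∑[ l ∈ colourings ] ∑[ r ∈ colourings ] ∑[ a ∈ allFin m ] ∑[ b ∈ allFin m ] guardedJoin x l r a b)
        ≈⟨ ∑-cong colourings (λ l → ∑-cong colourings (∑-guardedJoin x l)) ⟩
      (∑[ l ∈ colourings ] ∑[ r ∈ colourings ] joinTerm x l r)
        ∎
      where
      expand : ∀ a b → when (does (a ⊕ b ≟ᶠ x)) (Pjoin d (a , b)) ≋
                       (∑[ l ∈ colourings ] ∑[ r ∈ colourings ] guardedJoin x l r a b)
      expand a b = trans (when-cong g (Pjoin-expand a b))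
                         (trans (when-∑ g colourings _) (∑-cong colourings (λ l → when-∑ g colourings _)))
        where g = does (a ⊕ b ≟ᶠ x)

  Proot-suc : ∀ d x → Proot (suc d) x ≋ (∑[ p ∈ colourPairs ] when (does (proj₁ p ⊕ proj₂ p ≟ᶠ x)) (Pjoin d p))
  Proot-suc d x = trans (Proot-suc-as-joins {d} x) (sym (∑-Pjoin-as-joins {d} x))

module Construction {c ℓ} (F : Field c ℓ) (m : ℕ) .{{_ : NonZero m}} where
  open Poly F
  open NCPolynomials F
  open Circuits F
  open LegalColourings F m
  open CommutativeMonoid (+P-commutativeMonoid m) using (setoid; refl; sym; trans; reflexive)
  open Data.Nat using (_+_; _*_)

  treeShape : ℕ → Shape
  treeShape zero    = leafS
  treeShape (suc d) = addS (mulS (treeShape d ∷ leafS ∷ treeShape d ∷ []))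

  record Stage (d : ℕ) : Set (c ⊔ ℓ) where
    field
      gates          : ℕ
      circuit        : Circuit m gates
      varGate        : Fin m → Fin gates
      rootGate       : Fin m → Fin gates
      eval-varGate   : ∀ x → eval circuit (varGate x) ≋ varP x
      eval-rootGate  : ∀ x → eval circuit (rootGate x) ≋ Proot d x
      shape-varGate  : ∀ x → UniqueShape circuit (varGate x) leafS
      shape-rootGate : ∀ x → UniqueShape circuit (rootGate x) (treeShape d)
      size-bound     : size circuit ≤ m + d * (6 * (m * m))

  initialStage : Stage 0
  initialStage = record
    { gates          = m + 0
    ; circuit        = extend m var []
    ; varGate        = _↑ˡ 0
    ; rootGate       = _↑ˡ 0
    ; eval-varGate   = eval-extend-new m var []
    ; eval-rootGate  = λ x → trans (eval-extend-new m var [] x) (sym (Proot-zero x))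
    ; shape-varGate  = λ x → uniqueShape-extend-new m var [] x (var-shaped x)
    ; shape-rootGate = λ x → uniqueShape-extend-new m var [] x (var-shaped x)
    ; size-bound     = ℕP.≤-reflexive (≡.trans (size-extend m var [])
                         (≡.cong (_+ 0) (≡.trans (length-as-∑ (allFin m)) (length-allFin m))))
    }

  layer-size-bound : ∀ d s → s ≤ m + d * (6 * (m * m)) → m + m * m + (m * m * 4 + s) ≤ m + suc d * (6 * (m * m))
  layer-size-bound d s s≤ = begin
    m + m * m + (m * m * 4 + s)                        ≤⟨ ℕP.+-monoʳ-≤ (m + m * m) (ℕP.+-monoʳ-≤ (m * m * 4) s≤) ⟩
    m + m * m + (m * m * 4 + (m + d * (6 * (m * m))))  ≡⟨ regroup m d ⟩
    m + (m + (m * m * 5 + d * (6 * (m * m))))          ≤⟨ ℕP.+-monoʳ-≤ m (ℕP.+-monoˡ-≤ _ (ℕP.m≤m*n m m)) ⟩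
    m + (m * m + (m * m * 5 + d * (6 * (m * m))))      ≡⟨ ≡.cong (m +_) (collect m d) ⟩
    m + suc d * (6 * (m * m))                          ∎
    where
    open ℕP.≤-Reasoning
    regroup : ∀ m d → m + m * m + (m * m * 4 + (m + d * (6 * (m * m)))) ≡ m + (m + (m * m * 5 + d * (6 * (m * m))))
    regroup = solve-∀
    collect : ∀ m d → m * m + (m * m * 5 + d * (6 * (m * m))) ≡ suc d * (6 * (m * m))
    collect = solve-∀

  module NextStage {d} (S : Stage d) where
    open Stage S

    pairCount : ℕ
    pairCount = length colourPairs

    pair : Fin pairCount → Fin m × Fin m
    pair = lookup colourPairs

    joinGate : Fin pairCount → Gate m gates
    joinGate i = let (a , b) = pair i in mul (rootGate a ∷ varGate (a ⊕ b) ∷ rootGate b ∷ [])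

    withJoins : Circuit m (pairCount + gates)
    withJoins = extend pairCount joinGate circuit

    sumsTo : (x : Fin m) (i : Fin pairCount) → Dec (proj₁ (pair i) ⊕ proj₂ (pair i) ≡ x)
    sumsTo x i = proj₁ (pair i) ⊕ proj₂ (pair i) ≟ᶠ x

    joinsTo : Fin m → List (Fin pairCount)
    joinsTo x = filter (sumsTo x) (allFin pairCount)

    sumGate : Fin m → Gate m (pairCount + gates)
    sumGate x = add (map (_↑ˡ gates) (joinsTo x))

    withSums : Circuit m (m + (pairCount + gates))
    withSums = extend m sumGate withJoins

    eval-joinGate : ∀ i → evalGate (joinGate i) (eval circuit) ≋ Pjoin d (pair i)
    eval-joinGate i = *P-cong (eval-rootGate a) (*P-cong (eval-varGate (a ⊕ b)) (*P-cong (eval-rootGate b) refl))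
      where
      a = proj₁ (pair i)
      b = proj₂ (pair i)

    eval-sumGate : ∀ x → eval withSums (x ↑ˡ (pairCount + gates)) ≋ Proot (suc d) x
    eval-sumGate x = begin
      eval withSums (x ↑ˡ _)
        ≈⟨ eval-extend-new m sumGate withJoins x ⟩
      sumOver (map (_↑ˡ gates) (joinsTo x)) (eval withJoins)
        ≡⟨ ∑-map (_↑ˡ gates) (joinsTo x) (eval withJoins) ⟩
      (∑[ i ∈ joinsTo x ] eval withJoins (i ↑ˡ gates))
        ≈⟨ ∑-cong (joinsTo x) (λ i → trans (eval-extend-new pairCount joinGate circuit i) (eval-joinGate i)) ⟩
      (∑[ i ∈ joinsTo x ] Pjoin d (pair i))
        ≈⟨ ∑-filter (sumsTo x) (allFin pairCount) (Pjoin d ∘ pair) ⟩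
      (∑[ i ∈ allFin pairCount ] when (does (sumsTo x i)) (Pjoin d (pair i)))
        ≡⟨ ∑-lookup colourPairs (λ p → when (does (proj₁ p ⊕ proj₂ p ≟ᶠ x)) (Pjoin d p)) ⟩
      (∑[ p ∈ colourPairs ] when (does (proj₁ p ⊕ proj₂ p ≟ᶠ x)) (Pjoin d p))
        ≈⟨ Proot-suc d x ⟨
      Proot (suc d) x
        ∎
      where
      open ≈-Reasoning setoid
      open ListSum (+P-commutativeMonoid m) using (sumOver; ∑-cong; ∑-map; ∑-filter; ∑-lookup)

    shape-joinGate : ∀ i → UniqueShape withJoins (i ↑ˡ gates) (mulS (treeShape d ∷ leafS ∷ treeShape d ∷ []))
    shape-joinGate i = uniqueShape-extend-new pairCount joinGate circuit i
      (mul-shaped (shape-rootGate _ ∷ shape-varGate _ ∷ shape-rootGate _ ∷ []))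

    shape-sumGate : ∀ x → UniqueShape withSums (x ↑ˡ (pairCount + gates)) (treeShape (suc d))
    shape-sumGate x = uniqueShape-extend-new m sumGate withJoins x
      (add-shaped (map⁺ (All.universal shape-joinGate (joinsTo x))))

    pairCount≡ : pairCount ≡ m * m
    pairCount≡ = ≡.trans (length-cartesianProduct (allFin m) (allFin m)) (≡.cong₂ _*_ (length-allFin m) (length-allFin m))

    size-withJoins : size withJoins ≡ m * m * 4 + size circuit
    size-withJoins = begin
      size withJoins
        ≡⟨ size-extend pairCount joinGate circuit ⟩
      (∑[ _ ∈ allFin pairCount ] 4) + size circuit
        ≡⟨ ≡.cong (_+ size circuit) (∑-const (allFin pairCount) 4) ⟩
      length (allFin pairCount) * 4 + size circuit
        ≡⟨ ≡.cong (λ n → n * 4 + size circuit) (≡.trans (length-allFin pairCount) pairCount≡) ⟩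
      m * m * 4 + size circuit
        ∎
      where
      open ≡.≡-Reasoning
      open ℕ∑ using (sumOver)

    size-withSums : size withSums ≡ m + m * m + size withJoins
    size-withSums = ≡.trans (size-extend m sumGate withJoins) (≡.cong (_+ size withJoins) (begin
      (∑[ x ∈ allFin m ] suc (length (map (_↑ˡ gates) (joinsTo x))))
        ≡⟨ ∑-suc (allFin m) _ ⟩
      length (allFin m) + (∑[ x ∈ allFin m ] length (map (_↑ˡ gates) (joinsTo x)))
        ≡⟨ ≡.cong₂ _+_ (length-allFin m) (ℕ∑.∑-cong (allFin m) (λ x → length-map _ (joinsTo x))) ⟩
      m + (∑[ x ∈ allFin m ] length (joinsTo x))
        ≡⟨ ≡.cong (m +_) (∑-length-filter-≟ (λ i → proj₁ (pair i) ⊕ proj₂ (pair i)) (allFin pairCount)) ⟩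
      m + length (allFin pairCount)
        ≡⟨ ≡.cong (m +_) (≡.trans (length-allFin pairCount) pairCount≡) ⟩
      m + m * m
        ∎))
      where
      open ≡.≡-Reasoning
      open ℕ∑ using (sumOver)

    nextStage : Stage (suc d)
    nextStage = record
      { gates          = m + (pairCount + gates)
      ; circuit        = withSums
      ; varGate        = λ x → m ↑ʳ (pairCount ↑ʳ varGate x)
      ; rootGate       = _↑ˡ (pairCount + gates)
      ; eval-varGate   = λ x → trans (reflexive (≡.trans (eval-extend-old m sumGate withJoins _)
                                                          (eval-extend-old pairCount joinGate circuit (varGate x))))
                                     (eval-varGate x)
      ; eval-rootGate  = eval-sumGate
      ; shape-varGate  = λ x → uniqueShape-extend-old m sumGate withJoins
                                 (uniqueShape-extend-old pairCount joinGate circuit (shape-varGate x))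
      ; shape-rootGate = shape-sumGate
      ; size-bound     = ℕP.≤-trans (ℕP.≤-reflexive (≡.trans size-withSums (≡.cong (m + m * m +_) size-withJoins)))
                                    (layer-size-bound d (size circuit) size-bound)
      }

  stage : ∀ d → Stage d
  stage zero    = initialStage
  stage (suc d) = NextStage.nextStage (stage d)

  output-size-bound : ∀ d .{{_ : NonZero d}} s → s ≤ m + d * (6 * (m * m)) → suc (m + s) ≤ 9 * (m * m * d)
  output-size-bound d s s≤ = begin
    suc (m + s)                        ≤⟨ ℕ.s≤s (ℕP.+-monoʳ-≤ m s≤) ⟩
    suc (m + (m + d * (6 * (m * m))))  ≡⟨ regroup m d ⟩
    1 + m + m + 6 * X                  ≤⟨ ℕP.+-monoˡ-≤ (6 * X) (ℕP.+-mono-≤ (ℕP.+-mono-≤ 1≤X m≤X) m≤X) ⟩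
    X + X + X + 6 * X                  ≡⟨ collect X ⟩
    9 * X                              ∎
    where
    open ℕP.≤-Reasoning
    X = m * m * d
    m≤X : m ≤ X
    m≤X = ℕP.≤-trans (ℕP.m≤m*n m m) (ℕP.m≤m*n (m * m) d)
    1≤X : 1 ≤ X
    1≤X = ℕP.≤-trans (ℕ.>-nonZero⁻¹ m) m≤X
    regroup : ∀ m d → suc (m + (m + d * (6 * (m * m)))) ≡ 1 + m + m + 6 * (m * m * d)
    regroup = solve-∀
    collect : ∀ X → X + X + X + 6 * X ≡ 9 * X
    collect = solve-∀

  module _ (d : ℕ) where
    open Stage (stage d)

    P-circuit : Circuit m (suc gates)
    P-circuit = add (map rootGate (allFin m)) ∷ circuit

    P-circuit-UPT : UPT P-circuit
    P-circuit-UPT = uniqueShape⇒UPT (uniqueShape-top (add-shaped (map⁺ (All.universal shape-rootGate (allFin m)))))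

    P-circuit-correct : output P-circuit ≋ P m d
    P-circuit-correct = begin
      output P-circuit                                ≡⟨ ∑-map rootGate (allFin m) (eval circuit) ⟩
      (∑[ x ∈ allFin m ] eval circuit (rootGate x))   ≈⟨ ∑-cong (allFin m) eval-rootGate ⟩
      (∑[ x ∈ allFin m ] Proot d x)                   ≈⟨ P≋∑Proot d ⟨
      P m d                                           ∎
      where
      open ≈-Reasoning setoid
      open ListSum (+P-commutativeMonoid m) using (sumOver; ∑-cong; ∑-map)

    P-circuit-size : .{{_ : NonZero d}} → size P-circuit ≤ 9 * (m * m * d)
    P-circuit-size = ℕP.≤-trans
      (ℕP.≤-reflexive (≡.cong (λ n → suc (n + size circuit)) (≡.trans (length-map rootGate (allFin m)) (length-allFin m))))
      (output-size-bound d (size circuit) size-bound)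

open Data.Nat using (_*_)

lemma4p1 : ∀ {c ℓ : Level} (F : Field c ℓ) → let open Poly F in
    ∃ λ (K : ℕ) → ∀ (m d : ℕ) → .{{_ : NonZero m}} → .{{_ : NonZero d}} →
      ∃ λ (n : ℕ) → Σ (Circuit m (suc n)) λ C →
        UPT C × output C ≋ P m d × size C ≤ K * (m * m * d)
lemma4p1 F = 9 , λ m d → let open Construction F m in
  Stage.gates (stage d) , P-circuit d , P-circuit-UPT d , P-circuit-correct d , P-circuit-size d
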